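{- For every computation $M$ of $\lambda_{\copyright}$, the following are equivalent: (1) $M \to_{\copyright}^* !V$ for some value $V$; (2) the (unique) maximal $\to^{\mathsf w}_{\beta_c}$-sequence from $M$ is finite and ends in a term of the form $!W$; (3) the (unique) maximal $\mapsto_{\beta_c\sigma}$-sequence from $M$ is finite and ends in a term of the form $!W$.
   Context: The computational core $\lambda_{\copyright}$ has values $V,W ::= x \mid \lambda x.M$ and computations $M,N,L ::= \,!V \mid VM$ ($x$ ranging over a countable set of variables, terms up to $\alpha$-renaming; $M\{V/x\}$ is capture-avoiding substitution). Root rules on computations: $\beta_c$: $(\lambda x.M)(!V) \mapsto M\{V/x\}$; $\mathsf{id}$: $(\lambda x.!x)M \mapsto M$; $\sigma$: $(\lambda y.N)((\lambda x.M)L) \mapsto (\lambda x.(\lambda y.N)M)L$ provided $x\notin \mathrm{fv}(N)$; $\copyright=\beta_c\cup\mathsf{id}\cup\sigma$; $\mapsto_{\beta_c\sigma} = \mapsto_{\beta_c}\cup\mapsto_{\sigma}$ is the union of the root rules themselves (no contextual closure), which is a deterministic relation. Contexts: $C ::= [\,] \mid\, !(\lambda x.C) \mid VC \mid (\lambda x.C)M$; weak contexts: $W ::= [\,]\mid VW$. $\to_\rho$ is the closure of rule $\rho$ under all contexts, and $\to^{\mathsf w}_\rho$ its closure under weak contexts; $\to^{\mathsf w}_{\beta_c}$ is deterministic. $\to^*$ is reflexive–transitive closure. -}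

module Defs where

open import Data.Nat using (ℕ; zero; suc)
open import Data.Fin using (Fin; zero; suc)
open import Data.Product using (Σ; ∃; _×_; _,_)
open import Relation.Nullary using (¬_)
open import Relation.Binary.PropositionalEquality using (_≡_)
open import Relation.Binary.Construct.Closure.ReflexiveTransitive using (Star)

-- Well-scoped de Bruijn syntax of the computational core λ©
-- (terms up to α-renaming; n = number of free variables in scope).
mutual
  data Val (n : ℕ) : Set where
    var : Fin n → Val n
    lam : Comp (suc n) → Val n

  data Comp (n : ℕ) : Set where
    ret : Val n → Comp n
    app : Val n → Comp n → Comp n

Ren : ℕ → ℕ → Set
Ren n m = Fin n → Fin m

extR : ∀ {n m} → Ren n m → Ren (suc n) (suc m)
extR ρ zero    = zero
extR ρ (suc i) = suc (ρ i)

mutual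
  renV : ∀ {n m} → Ren n m → Val n → Val m
  renV ρ (var i) = var (ρ i)
  renV ρ (lam M) = lam (renC (extR ρ) M)

  renC : ∀ {n m} → Ren n m → Comp n → Comp m
  renC ρ (ret V)   = ret (renV ρ V)
  renC ρ (app V M) = app (renV ρ V) (renC ρ M)

Sub : ℕ → ℕ → Set
Sub n m = Fin n → Val m

extS : ∀ {n m} → Sub n m → Sub (suc n) (suc m)
extS σ zero    = var zero
extS σ (suc i) = renV suc (σ i)

mutual
  subV : ∀ {n m} → Sub n m → Val n → Val m
  subV σ (var i) = σ i
  subV σ (lam M) = lam (subC (extS σ) M)

  subC : ∀ {n m} → Sub n m → Comp n → Comp m
  subC σ (ret V)   = ret (subV σ V)
  subC σ (app V M) = app (subV σ V) (subC σ M)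

sub0 : ∀ {n} → Val n → Sub (suc n) n
sub0 V zero    = V
sub0 V (suc i) = var i

_[_] : ∀ {n} → Comp (suc n) → Val n → Comp n
M [ V ] = subC (sub0 V) M

data RootβC {n : ℕ} : Comp n → Comp n → Set where
  βc : ∀ (M : Comp (suc n)) (V : Val n) → RootβC (app (lam M) (ret V)) (M [ V ])

data RootId {n : ℕ} : Comp n → Comp n → Set where
  idr : ∀ (M : Comp n) → RootId (app (lam (ret (var zero))) M) M

-- In de Bruijn form, N lives in scope (suc n) (index 0 = y); the side
-- condition x ∉ fv(N) is built in: in the result N is weakened past x,
-- i.e. renamed by 0 ↦ 0, suc i ↦ suc (suc i).
data RootSigma {n : ℕ} : Comp n → Comp n → Set where
  σr : ∀ (N : Comp (suc n)) (M : Comp (suc n)) (L : Comp n) →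
       RootSigma (app (lam N) (app (lam M) L))
                 (app (lam (app (lam (renC (extR suc) N)) M)) L)

data RootCopy {n : ℕ} (M N : Comp n) : Set where
  viaβ  : RootβC M N → RootCopy M N
  viaId : RootId M N → RootCopy M N
  viaσ  : RootSigma M N → RootCopy M N

data RootβCσ {n : ℕ} (M N : Comp n) : Set where
  viaβ : RootβC M N → RootβCσ M N
  viaσ : RootSigma M N → RootβCσ M N

Rel : Set₁
Rel = ∀ {n} → Comp n → Comp n → Set

data Ctx (R : Rel) : Rel where
  hole   : ∀ {n} {M N : Comp n} → R M N → Ctx R M N
  retLam : ∀ {n} {M N : Comp (suc n)} → Ctx R M N → Ctx R (ret (lam M)) (ret (lam N))
  appR   : ∀ {n} (V : Val n) {M N : Comp n} → Ctx R M N → Ctx R (app V M) (app V N)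
  appLam : ∀ {n} {M N : Comp (suc n)} (L : Comp n) → Ctx R M N → Ctx R (app (lam M) L) (app (lam N) L)

data Weak (R : Rel) : Rel where
  hole : ∀ {n} {M N : Comp n} → R M N → Weak R M N
  appR : ∀ {n} (V : Val n) {M N : Comp n} → Weak R M N → Weak R (app V M) (app V N)

_→©_ : Rel
_→©_ = Ctx RootCopy

_→wβc_ : Rel
_→wβc_ = Weak RootβC

_⟶*[_]_ : ∀ {n} → Comp n → (∀ {m} → Comp m → Comp m → Set) → Comp n → Set
M ⟶*[ R ] N = Star R M N

Normal : ∀ {n} → (Comp n → Comp n → Set) → Comp n → Set
Normal R M = ∀ N → ¬ R M N

-- "the (unique) maximal R-sequence from M is finite and ends in a term !W":
-- R is deterministic, so the maximal sequence is finite iff M reaches an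
-- R-normal form N, and it ends in !W iff that N is !W.
MaxSeqEndsInRet : ∀ {n} → (∀ {m} → Comp m → Comp m → Set) → Comp n → Set
MaxSeqEndsInRet {n} R M =
  Σ (Comp n) λ N → Star R M N × Normal R N × Σ (Val n) λ W → N ≡ ret W

-- Each condition is equivalent to convergence of M under the big-step call-by-value
-- evaluation  !V ⇓ V,  and  (λx.Q) N ⇓ W  whenever  N ⇓ U  and  Q{U/x} ⇓ W.
-- Weak β_c-reduction follows this evaluation literally, and root β_cσ-reduction does
-- too once σ has rotated the nested argument  (λx.P) L  of a head application to the
-- top; conversely, expanding a weak or root step preserves ⇓. For unrestricted
-- ©-reduction the point is that convergence is reflected along parallel ©-reduction
-- ⇛: if P ⇛ P′ and P′ ⇓ W then P ⇓ W′ for some W′ ⇛ W. So a ©-reduction to a value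
-- forces M ⇓ W, and then weak reduction reaches !W.

module Submission where

open import Defs
open import Data.Nat using (ℕ; zero; suc; _≤_; _⊔_; s≤s)
open import Data.Nat.Properties using (m≤m⊔n; m≤n⊔m)
open import Data.Fin using (Fin; zero; suc)
open import Data.Product using (Σ; ∃; _×_; _,_)
open import Function.Base using (_∘_)
open import Function.Bundles using (_⇔_; mk⇔)
import Function.Properties.Equivalence as ⇔
open import Relation.Binary.PropositionalEquality
  using (_≡_; _≗_; refl; sym; trans; cong; cong₂; subst; module ≡-Reasoning)
open import Relation.Binary.Construct.Closure.ReflexiveTransitive
  using (Star; ε; _◅_; _◅◅_; gmap; map)

private
  variable
    n m k : ℕ

extR-cong : {ρ ρ′ : Ren n m} → ρ ≗ ρ′ → extR ρ ≗ extR ρ′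
extR-cong e zero    = refl
extR-cong e (suc i) = cong suc (e i)

mutual
  renV-cong : {ρ ρ′ : Ren n m} → ρ ≗ ρ′ → renV ρ ≗ renV ρ′
  renV-cong e (var i) = cong var (e i)
  renV-cong e (lam M) = cong lam (renC-cong (extR-cong e) M)

  renC-cong : {ρ ρ′ : Ren n m} → ρ ≗ ρ′ → renC ρ ≗ renC ρ′
  renC-cong e (ret V)   = cong ret (renV-cong e V)
  renC-cong e (app V M) = cong₂ app (renV-cong e V) (renC-cong e M)

extS-cong : {σ σ′ : Sub n m} → σ ≗ σ′ → extS σ ≗ extS σ′
extS-cong e zero    = refl
extS-cong e (suc i) = cong (renV suc) (e i)

mutual
  subV-cong : {σ σ′ : Sub n m} → σ ≗ σ′ → subV σ ≗ subV σ′
  subV-cong e (var i) = e i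
  subV-cong e (lam M) = cong lam (subC-cong (extS-cong e) M)

  subC-cong : {σ σ′ : Sub n m} → σ ≗ σ′ → subC σ ≗ subC σ′
  subC-cong e (ret V)   = cong ret (subV-cong e V)
  subC-cong e (app V M) = cong₂ app (subV-cong e V) (subC-cong e M)

extR-∘ : (ρ : Ren m k) (ρ′ : Ren n m) → extR ρ ∘ extR ρ′ ≗ extR (ρ ∘ ρ′)
extR-∘ ρ ρ′ zero    = refl
extR-∘ ρ ρ′ (suc i) = refl

mutual
  renV-renV : (ρ : Ren m k) (ρ′ : Ren n m) (V : Val n) → renV ρ (renV ρ′ V) ≡ renV (ρ ∘ ρ′) V
  renV-renV ρ ρ′ (var i) = refl
  renV-renV ρ ρ′ (lam M) =
    cong lam (trans (renC-renC (extR ρ) (extR ρ′) M) (renC-cong (extR-∘ ρ ρ′) M))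

  renC-renC : (ρ : Ren m k) (ρ′ : Ren n m) (M : Comp n) → renC ρ (renC ρ′ M) ≡ renC (ρ ∘ ρ′) M
  renC-renC ρ ρ′ (ret V)   = cong ret (renV-renV ρ ρ′ V)
  renC-renC ρ ρ′ (app V M) = cong₂ app (renV-renV ρ ρ′ V) (renC-renC ρ ρ′ M)

extS-∘-extR : (σ : Sub m k) (ρ : Ren n m) → extS σ ∘ extR ρ ≗ extS (σ ∘ ρ)
extS-∘-extR σ ρ zero    = refl
extS-∘-extR σ ρ (suc i) = refl

mutual
  subV-renV : (σ : Sub m k) (ρ : Ren n m) (V : Val n) → subV σ (renV ρ V) ≡ subV (σ ∘ ρ) V
  subV-renV σ ρ (var i) = refl
  subV-renV σ ρ (lam M) =
    cong lam (trans (subC-renC (extS σ) (extR ρ) M) (subC-cong (extS-∘-extR σ ρ) M))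

  subC-renC : (σ : Sub m k) (ρ : Ren n m) (M : Comp n) → subC σ (renC ρ M) ≡ subC (σ ∘ ρ) M
  subC-renC σ ρ (ret V)   = cong ret (subV-renV σ ρ V)
  subC-renC σ ρ (app V M) = cong₂ app (subV-renV σ ρ V) (subC-renC σ ρ M)

extR-∘-extS : (ρ : Ren m k) (σ : Sub n m) → renV (extR ρ) ∘ extS σ ≗ extS (renV ρ ∘ σ)
extR-∘-extS ρ σ zero    = refl
extR-∘-extS ρ σ (suc i) = trans (renV-renV (extR ρ) suc (σ i)) (sym (renV-renV suc ρ (σ i)))

mutual
  renV-subV : (ρ : Ren m k) (σ : Sub n m) (V : Val n) → renV ρ (subV σ V) ≡ subV (renV ρ ∘ σ) V
  renV-subV ρ σ (var i) = refl
  renV-subV ρ σ (lam M) =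
    cong lam (trans (renC-subC (extR ρ) (extS σ) M) (subC-cong (extR-∘-extS ρ σ) M))

  renC-subC : (ρ : Ren m k) (σ : Sub n m) (M : Comp n) → renC ρ (subC σ M) ≡ subC (renV ρ ∘ σ) M
  renC-subC ρ σ (ret V)   = cong ret (renV-subV ρ σ V)
  renC-subC ρ σ (app V M) = cong₂ app (renV-subV ρ σ V) (renC-subC ρ σ M)

extS-∘-extS : (τ : Sub m k) (σ : Sub n m) → subV (extS τ) ∘ extS σ ≗ extS (subV τ ∘ σ)
extS-∘-extS τ σ zero    = refl
extS-∘-extS τ σ (suc i) = trans (subV-renV (extS τ) suc (σ i)) (sym (renV-subV suc τ (σ i)))

mutual
  subV-subV : (τ : Sub m k) (σ : Sub n m) (V : Val n) → subV τ (subV σ V) ≡ subV (subV τ ∘ σ) V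
  subV-subV τ σ (var i) = refl
  subV-subV τ σ (lam M) =
    cong lam (trans (subC-subC (extS τ) (extS σ) M) (subC-cong (extS-∘-extS τ σ) M))

  subC-subC : (τ : Sub m k) (σ : Sub n m) (M : Comp n) → subC τ (subC σ M) ≡ subC (subV τ ∘ σ) M
  subC-subC τ σ (ret V)   = cong ret (subV-subV τ σ V)
  subC-subC τ σ (app V M) = cong₂ app (subV-subV τ σ V) (subC-subC τ σ M)

extS-var : extS {n} var ≗ var
extS-var zero    = refl
extS-var (suc i) = refl

mutual
  subV-var : (V : Val n) → subV var V ≡ V
  subV-var (var i) = refl
  subV-var (lam M) = cong lam (trans (subC-cong extS-var M) (subC-var M))

  subC-var : (M : Comp n) → subC var M ≡ M
  subC-var (ret V)   = cong ret (subV-var V)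
  subC-var (app V M) = cong₂ app (subV-var V) (subC-var M)

infixr 5 _∷ₛ_
_∷ₛ_ : Val m → Sub n m → Sub (suc n) m
(X ∷ₛ σ) zero    = X
(X ∷ₛ σ) (suc i) = σ i

subC-sub0-extS : (X : Val m) (σ : Sub n m) (A : Comp (suc n)) →
                 subC (extS σ) A [ X ] ≡ subC (X ∷ₛ σ) A
subC-sub0-extS X σ A = trans (subC-subC (sub0 X) (extS σ) A) (subC-cong sub0-∘-extS A)
  where
  sub0-∘-extS : subV (sub0 X) ∘ extS σ ≗ X ∷ₛ σ
  sub0-∘-extS zero    = refl
  sub0-∘-extS (suc i) = trans (subV-renV (sub0 X) suc (σ i)) (subV-var (σ i))

subC-[] : (σ : Sub n m) (B : Val n) (A : Comp (suc n)) →
          subC σ (A [ B ]) ≡ subC (subV σ B ∷ₛ σ) A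
subC-[] σ B A = trans (subC-subC σ (sub0 B) A) (subC-cong subV-∘-sub0 A)
  where
  subV-∘-sub0 : subV σ ∘ sub0 B ≗ subV σ B ∷ₛ σ
  subV-∘-sub0 zero    = refl
  subV-∘-sub0 (suc i) = refl

subC-[]-commute : (σ : Sub n m) (B : Val n) (A : Comp (suc n)) →
                  subC σ (A [ B ]) ≡ subC (extS σ) A [ subV σ B ]
subC-[]-commute σ B A = trans (subC-[] σ B A) (sym (subC-sub0-extS (subV σ B) σ A))

renC-[]-commute : (ρ : Ren n m) (B : Val n) (A : Comp (suc n)) →
                  renC ρ (A [ B ]) ≡ renC (extR ρ) A [ renV ρ B ]
renC-[]-commute ρ B A =
  trans (renC-subC ρ (sub0 B) A)
        (trans (subC-cong renV-∘-sub0 A) (sym (subC-renC (sub0 (renV ρ B)) (extR ρ) A)))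
  where
  renV-∘-sub0 : renV ρ ∘ sub0 B ≗ sub0 (renV ρ B) ∘ extR ρ
  renV-∘-sub0 zero    = refl
  renV-∘-sub0 (suc i) = refl

weaken₁ : Comp (suc n) → Comp (suc (suc n))
weaken₁ = renC (extR suc)

renC-weaken₁ : (ρ : Ren n m) (A : Comp (suc n)) →
               renC (extR (extR ρ)) (weaken₁ A) ≡ weaken₁ (renC (extR ρ) A)
renC-weaken₁ ρ A =
  trans (renC-renC (extR (extR ρ)) (extR suc) A)
        (trans (renC-cong commute A) (sym (renC-renC (extR suc) (extR ρ) A)))
  where
  commute : extR (extR ρ) ∘ extR suc ≗ extR suc ∘ extR ρ
  commute zero    = refl
  commute (suc i) = refl

subC-weaken₁ : (σ : Sub n m) (A : Comp (suc n)) →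
               subC (extS (extS σ)) (weaken₁ A) ≡ weaken₁ (subC (extS σ) A)
subC-weaken₁ σ A =
  trans (subC-renC (extS (extS σ)) (extR suc) A)
        (trans (subC-cong commute A) (sym (renC-subC (extR suc) (extS σ) A)))
  where
  commute : extS (extS σ) ∘ extR suc ≗ renV (extR suc) ∘ extS σ
  commute zero    = refl
  commute (suc i) = trans (renV-renV suc suc (σ i)) (sym (renV-renV (extR suc) suc (σ i)))

subC-extS-sub0-weaken₁ : (U : Val n) (A : Comp (suc n)) → subC (extS (sub0 U)) (weaken₁ A) ≡ A
subC-extS-sub0-weaken₁ U A =
  trans (subC-renC (extS (sub0 U)) (extR suc) A) (trans (subC-cong cancel A) (subC-var A))
  where
  cancel : extS (sub0 U) ∘ extR suc ≗ var
  cancel zero    = refl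
  cancel (suc i) = refl

infix 4 _⇛v_ _⇛_ _⇛ₛ_

mutual
  data _⇛v_ : Val n → Val n → Set where
    var : {i : Fin n} → var i ⇛v var i
    lam : {M M′ : Comp (suc n)} → M ⇛ M′ → lam M ⇛v lam M′

  data _⇛_ : Comp n → Comp n → Set where
    ret : {V V′ : Val n} → V ⇛v V′ → ret V ⇛ ret V′
    app : {V V′ : Val n} {M M′ : Comp n} → V ⇛v V′ → M ⇛ M′ → app V M ⇛ app V′ M′
    βc  : {M M′ : Comp (suc n)} {V V′ : Val n} →
          M ⇛ M′ → V ⇛v V′ → app (lam M) (ret V) ⇛ M′ [ V′ ]
    idr : {M M′ : Comp n} → M ⇛ M′ → app (lam (ret (var zero))) M ⇛ M′
    σr  : {N N′ M M′ : Comp (suc n)} {L L′ : Comp n} → N ⇛ N′ → M ⇛ M′ → L ⇛ L′ →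
          app (lam N) (app (lam M) L) ⇛ app (lam (app (lam (weaken₁ N′)) M′)) L′

mutual
  ⇛v-refl : (V : Val n) → V ⇛v V
  ⇛v-refl (var i) = var
  ⇛v-refl (lam M) = lam (⇛-refl M)

  ⇛-refl : (M : Comp n) → M ⇛ M
  ⇛-refl (ret V)   = ret (⇛v-refl V)
  ⇛-refl (app V M) = app (⇛v-refl V) (⇛-refl M)

→©⇒⇛ : {M N : Comp n} → M →© N → M ⇛ N
→©⇒⇛ (hole (viaβ (βc M V)))    = βc (⇛-refl M) (⇛v-refl V)
→©⇒⇛ (hole (viaId (idr M)))    = idr (⇛-refl M)
→©⇒⇛ (hole (viaσ (σr N M L)))  = σr (⇛-refl N) (⇛-refl M) (⇛-refl L)
→©⇒⇛ (retLam s)                = ret (lam (→©⇒⇛ s))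
→©⇒⇛ (appR V s)                = app (⇛v-refl V) (→©⇒⇛ s)
→©⇒⇛ (appLam L s)              = app (lam (→©⇒⇛ s)) (⇛-refl L)

mutual
  ⇛v-renV : (ρ : Ren n m) {V V′ : Val n} → V ⇛v V′ → renV ρ V ⇛v renV ρ V′
  ⇛v-renV ρ var     = var
  ⇛v-renV ρ (lam p) = lam (⇛-renC (extR ρ) p)

  ⇛-renC : (ρ : Ren n m) {M M′ : Comp n} → M ⇛ M′ → renC ρ M ⇛ renC ρ M′
  ⇛-renC ρ (ret v)   = ret (⇛v-renV ρ v)
  ⇛-renC ρ (app v p) = app (⇛v-renV ρ v) (⇛-renC ρ p)
  ⇛-renC ρ (βc {M′ = M′} {V′ = V′} p v) =
    subst (_ ⇛_) (sym (renC-[]-commute ρ V′ M′)) (βc (⇛-renC (extR ρ) p) (⇛v-renV ρ v))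
  ⇛-renC ρ (idr p)   = idr (⇛-renC ρ p)
  ⇛-renC ρ (σr {N′ = N′} {M′ = M′} {L′ = L′} pn pm pl) =
    subst (λ X → _ ⇛ app (lam (app (lam X) (renC (extR ρ) M′))) (renC ρ L′))
          (sym (renC-weaken₁ ρ N′))
          (σr (⇛-renC (extR ρ) pn) (⇛-renC (extR ρ) pm) (⇛-renC ρ pl))

_⇛ₛ_ : Sub n m → Sub n m → Set
σ ⇛ₛ σ′ = ∀ i → σ i ⇛v σ′ i

⇛ₛ-extS : {σ σ′ : Sub n m} → σ ⇛ₛ σ′ → extS σ ⇛ₛ extS σ′
⇛ₛ-extS ss zero    = var
⇛ₛ-extS ss (suc i) = ⇛v-renV suc (ss i)

⇛ₛ-∷ₛ : {σ σ′ : Sub n m} {X X′ : Val m} → X ⇛v X′ → σ ⇛ₛ σ′ → X ∷ₛ σ ⇛ₛ X′ ∷ₛ σ′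
⇛ₛ-∷ₛ x ss zero    = x
⇛ₛ-∷ₛ x ss (suc i) = ss i

⇛ₛ-sub0 : {X X′ : Val n} → X ⇛v X′ → sub0 X ⇛ₛ sub0 X′
⇛ₛ-sub0 x zero    = x
⇛ₛ-sub0 x (suc i) = var

mutual
  ⇛v-subV : {σ σ′ : Sub n m} → σ ⇛ₛ σ′ → {V V′ : Val n} → V ⇛v V′ → subV σ V ⇛v subV σ′ V′
  ⇛v-subV ss (var {i = i}) = ss i
  ⇛v-subV ss (lam p)       = lam (⇛-subC (⇛ₛ-extS ss) p)

  ⇛-subC : {σ σ′ : Sub n m} → σ ⇛ₛ σ′ → {M M′ : Comp n} → M ⇛ M′ → subC σ M ⇛ subC σ′ M′
  ⇛-subC ss (ret v)   = ret (⇛v-subV ss v)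
  ⇛-subC ss (app v p) = app (⇛v-subV ss v) (⇛-subC ss p)
  ⇛-subC {σ′ = σ′} ss (βc {M′ = M′} {V′ = V′} p v) =
    subst (_ ⇛_) (sym (subC-[]-commute σ′ V′ M′)) (βc (⇛-subC (⇛ₛ-extS ss) p) (⇛v-subV ss v))
  ⇛-subC ss (idr p)   = idr (⇛-subC ss p)
  ⇛-subC {σ′ = σ′} ss (σr {N′ = N′} {M′ = M′} {L′ = L′} pn pm pl) =
    subst (λ X → _ ⇛ app (lam (app (lam X) (subC (extS σ′) M′))) (subC σ′ L′))
          (sym (subC-weaken₁ σ′ N′))
          (σr (⇛-subC (⇛ₛ-extS ss) pn) (⇛-subC (⇛ₛ-extS ss) pm) (⇛-subC ss pl))

⇛v-lam-inv : {X : Val n} {Q : Comp (suc n)} → X ⇛v lam Q → ∃ λ R → X ≡ lam R × R ⇛ Q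
⇛v-lam-inv (lam p) = _ , refl , p

infix 4 _⇓_ _⇓[_]_

data _⇓_ : Comp n → Val n → Set where
  ret : {V : Val n} → ret V ⇓ V
  app : {Q : Comp (suc n)} {N : Comp n} {U W : Val n} →
        N ⇓ U → Q [ U ] ⇓ W → app (lam Q) N ⇓ W

Converges : Comp n → Set
Converges M = ∃ (M ⇓_)

data _⇓[_]_ : Comp n → ℕ → Val n → Set where
  ret : {V : Val n} → ret V ⇓[ k ] V
  app : {Q : Comp (suc n)} {N : Comp n} {U W : Val n} →
        N ⇓[ k ] U → Q [ U ] ⇓[ k ] W → app (lam Q) N ⇓[ suc k ] W

⇓[]-mono : ∀ {j} {M : Comp n} {W : Val n} → k ≤ j → M ⇓[ k ] W → M ⇓[ j ] W
⇓[]-mono le      ret       = ret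
⇓[]-mono (s≤s le) (app a b) = app (⇓[]-mono le a) (⇓[]-mono le b)

⇓⇒⇓[] : {M : Comp n} {W : Val n} → M ⇓ W → ∃ λ k → M ⇓[ k ] W
⇓⇒⇓[] ret = 0 , ret
⇓⇒⇓[] (app a b) with ⇓⇒⇓[] a | ⇓⇒⇓[] b
... | i , a′ | j , b′ = suc (i ⊔ j) , app (⇓[]-mono (m≤m⊔n i j) a′) (⇓[]-mono (m≤n⊔m i j) b′)

app-⇓[]-inv : {V : Val n} {N : Comp n} {W : Val n} → app V N ⇓[ suc k ] W →
              ∃ λ Q → V ≡ lam Q × ∃ λ U → N ⇓[ k ] U × Q [ U ] ⇓[ k ] W
app-⇓[]-inv (app a b) = _ , refl , _ , a , b

subC-weaken₁-[] : (σ : Sub n m) (U U₂ : Val m) (A : Comp (suc n)) →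
                  subC (extS (sub0 U)) (subC (extS (extS σ)) (weaken₁ A)) [ U₂ ] ≡ subC (U₂ ∷ₛ σ) A
subC-weaken₁-[] σ U U₂ A = begin
  subC (extS (sub0 U)) (subC (extS (extS σ)) (weaken₁ A)) [ U₂ ]
    ≡⟨ cong (λ X → subC (extS (sub0 U)) X [ U₂ ]) (subC-weaken₁ σ A) ⟩
  subC (extS (sub0 U)) (weaken₁ (subC (extS σ) A)) [ U₂ ]
    ≡⟨ cong (_[ U₂ ]) (subC-extS-sub0-weaken₁ U (subC (extS σ) A)) ⟩
  subC (extS σ) A [ U₂ ]
    ≡⟨ subC-sub0-extS U₂ σ A ⟩
  subC (U₂ ∷ₛ σ) A ∎
  where open ≡-Reasoning

-- Generalising over a
-- parallel substitution lets the β_c case push its argument into the substitution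
-- instead of recursing on a substituted (hence not structurally smaller) step.
⇛-subC-reflects-⇓ : ∀ k {P P′ : Comp n} {σ σ′ : Sub n m} {W : Val m} →
                    P ⇛ P′ → σ ⇛ₛ σ′ → subC σ′ P′ ⇓[ k ] W →
                    ∃ λ W′ → subC σ P ⇓ W′ × W′ ⇛v W
⇛-subC-reflects-⇓ k (ret v) ss ret = _ , ret , ⇛v-subV ss v
⇛-subC-reflects-⇓ zero (app v p) ss ()
⇛-subC-reflects-⇓ (suc k) {σ = σ} (app {V = V} {M = N} v p) ss d
  with app-⇓[]-inv d
... | Q , V′≡λQ , U , dN , dQ
  with ⇛v-lam-inv (subst (subV σ V ⇛v_) V′≡λQ (⇛v-subV ss v))
... | R , V≡λR , R⇛Q
  with ⇛-subC-reflects-⇓ k p ss dN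
... | U₀ , eN , U₀⇛U
  with ⇛-subC-reflects-⇓ k R⇛Q (⇛ₛ-sub0 U₀⇛U) dQ
... | W′ , eR , W′⇛W =
  W′ , subst (λ X → app X (subC σ N) ⇓ W′) (sym V≡λR) (app eN eR) , W′⇛W
⇛-subC-reflects-⇓ k {σ = σ} {σ′} {W} (βc {M = A} {A′} {B} {B′} pa pb) ss d
  with ⇛-subC-reflects-⇓ k pa (⇛ₛ-∷ₛ (⇛v-subV ss pb) ss) (subst (_⇓[ k ] W) (subC-[] σ′ B′ A′) d)
... | W′ , eA , W′⇛W =
  W′ , app ret (subst (_⇓ W′) (sym (subC-sub0-extS (subV σ B) σ A)) eA) , W′⇛W
⇛-subC-reflects-⇓ k (idr p) ss d with ⇛-subC-reflects-⇓ k p ss d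
... | W′ , e , W′⇛W = W′ , app e ret , W′⇛W
⇛-subC-reflects-⇓ zero (σr pa pb pl) ss ()
⇛-subC-reflects-⇓ (suc zero) (σr pa pb pl) ss (app dL ())
⇛-subC-reflects-⇓ (suc (suc k)) {σ = σ} {σ′} {W}
  (σr {N = A} {A′} {B} {B′} pa pb pl) ss (app {U = U} dL (app {U = U₂} dB dA))
  with ⇛-subC-reflects-⇓ (suc k) pl ss dL
... | U₀ , eL , U₀⇛U
  with ⇛-subC-reflects-⇓ k pb (⇛ₛ-∷ₛ U₀⇛U ss) (subst (_⇓[ k ] U₂) (subC-sub0-extS U σ′ B′) dB)
... | U₃ , eB , U₃⇛U₂
  with ⇛-subC-reflects-⇓ k pa (⇛ₛ-∷ₛ U₃⇛U₂ ss) (subst (_⇓[ k ] W) (subC-weaken₁-[] σ′ U U₂ A′) dA)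
... | W′ , eA , W′⇛W =
  W′ , app (app eL (subst (_⇓ U₃) (sym (subC-sub0-extS U₀ σ B)) eB))
           (subst (_⇓ W′) (sym (subC-sub0-extS U₃ σ A)) eA) , W′⇛W

⇛-reflects-converges : {P P′ : Comp n} → P ⇛ P′ → Converges P′ → Converges P
⇛-reflects-converges {P = P} {P′} p (W , d) with ⇓⇒⇓[] d
... | k , d′ with ⇛-subC-reflects-⇓ k p (λ i → var) (subst (_⇓[ k ] W) (sym (subC-var P′)) d′)
... | W′ , e , _ = W′ , subst (_⇓ W′) (subC-var P) e

→wβc⇒→© : {M N : Comp n} → M →wβc N → M →© N
→wβc⇒→© (hole r)   = hole (viaβ r)
→wβc⇒→© (appR V s) = appR V (→wβc⇒→© s)

→wβc-expand-⇓ : {M N : Comp n} {W : Val n} → M →wβc N → N ⇓ W → M ⇓ W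
→wβc-expand-⇓ (hole (βc Q V)) d       = app ret d
→wβc-expand-⇓ (appR V s) (app dN dQ) = app (→wβc-expand-⇓ s dN) dQ

⇓⇒→wβc* : {M : Comp n} {W : Val n} → M ⇓ W → Star _→wβc_ M (ret W)
⇓⇒→wβc* ret = ε
⇓⇒→wβc* (app {Q = Q} {U = U} dN dQ) =
  gmap (app (lam Q)) (appR (lam Q)) (⇓⇒→wβc* dN) ◅◅ hole (βc Q U) ◅ ⇓⇒→wβc* dQ

ret-→wβc-normal : (W : Val n) → Normal _→wβc_ (ret W)
ret-→wβc-normal W N (hole ())

↦βcσ-expand-⇓ : {M N : Comp n} {W : Val n} → RootβCσ M N → N ⇓ W → M ⇓ W
↦βcσ-expand-⇓ (viaβ (βc Q V)) d = app ret d
↦βcσ-expand-⇓ {W = W} (viaσ (σr Q P L)) (app {U = U₀} dL (app {U = U} dP dQ)) =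
  app (app dL dP) (subst (_⇓ W) (cong (_[ U ]) (subC-extS-sub0-weaken₁ U₀ Q)) dQ)

app-lam-↦βcσ* : (Q : Comp (suc n)) {N T : Comp n} {U : Val n} →
                N ⇓ U → Star RootβCσ (Q [ U ]) T → Star RootβCσ (app (lam Q) N) T
app-lam-↦βcσ* Q {U = U} ret r = viaβ (βc Q U) ◅ r
app-lam-↦βcσ* Q {T = T} (app {Q = P} {N = L} {U = U₀} dL dP) r =
  viaσ (σr Q P L) ◅ app-lam-↦βcσ* (app (lam (weaken₁ Q)) P) dL
    (subst (λ X → Star RootβCσ (app (lam X) (P [ U₀ ])) T)
           (sym (subC-extS-sub0-weaken₁ U₀ Q))
           (app-lam-↦βcσ* Q dP r))

⇓⇒↦βcσ* : {M : Comp n} {W : Val n} → M ⇓ W → Star RootβCσ M (ret W)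
⇓⇒↦βcσ* ret             = ε
⇓⇒↦βcσ* (app {Q = Q} dN dQ) = app-lam-↦βcσ* Q dN (⇓⇒↦βcσ* dQ)

ret-↦βcσ-normal : (W : Val n) → Normal RootβCσ (ret W)
ret-↦βcσ-normal W N (viaβ ())
ret-↦βcσ-normal W N (viaσ ())

module _ (R : Rel) where

  Star-reflects-converges : (∀ {n} {M N : Comp n} → R M N → Converges N → Converges M) →
                            {M : Comp n} {V : Val n} → Star R M (ret V) → Converges M
  Star-reflects-converges expand ε       = _ , ret
  Star-reflects-converges expand (s ◅ r) = expand s (Star-reflects-converges expand r)

  maxSeqEndsInRet⇔converges :
    (∀ {n} {M N : Comp n} → R M N → Converges N → Converges M) →
    (∀ {n} {M : Comp n} {W : Val n} → M ⇓ W → Star R M (ret W)) →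
    (∀ {n} (W : Val n) → Normal R (ret W)) →
    {M : Comp n} → MaxSeqEndsInRet R M ⇔ Converges M
  maxSeqEndsInRet⇔converges expand eval ret-normal = mk⇔
    (λ { (_ , r , _ , W , refl) → Star-reflects-converges expand r })
    (λ (W , d) → ret W , eval d , ret-normal W , W , refl)

→©*-ret⇔converges : {M : Comp n} → (∃ λ V → Star _→©_ M (ret V)) ⇔ Converges M
→©*-ret⇔converges = mk⇔
  (λ (_ , r) → Star-reflects-converges _→©_ (λ s → ⇛-reflects-converges (→©⇒⇛ s)) r)
  (λ (W , d) → W , map →wβc⇒→© (⇓⇒→wβc* d))

→wβc-maxSeqEndsInRet⇔converges : {M : Comp n} → MaxSeqEndsInRet _→wβc_ M ⇔ Converges M
→wβc-maxSeqEndsInRet⇔converges = maxSeqEndsInRet⇔converges _→wβc_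
  (λ s (W , d) → W , →wβc-expand-⇓ s d) ⇓⇒→wβc* ret-→wβc-normal

↦βcσ-maxSeqEndsInRet⇔converges : {M : Comp n} → MaxSeqEndsInRet RootβCσ M ⇔ Converges M
↦βcσ-maxSeqEndsInRet⇔converges = maxSeqEndsInRet⇔converges RootβCσ
  (λ s (W , d) → W , ↦βcσ-expand-⇓ s d) ⇓⇒↦βcσ* ret-↦βcσ-normal

mainTheorem2 : ∀ (n : ℕ) (M : Comp n) →
    ((Σ (Val n) λ V → Star _→©_ M (ret V)) ⇔ MaxSeqEndsInRet _→wβc_ M)
    × (MaxSeqEndsInRet _→wβc_ M ⇔ MaxSeqEndsInRet RootβCσ M)
mainTheorem2 n M =
  ⇔.trans →©*-ret⇔converges (⇔.sym →wβc-maxSeqEndsInRet⇔converges) ,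
  ⇔.trans →wβc-maxSeqEndsInRet⇔converges (⇔.sym ↦βcσ-maxSeqEndsInRet⇔converges)
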